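{- Let $\gamma,\rho$ be coprime positive integers with $\gamma<\rho$ and $N=\gamma+\rho$. Let $\sigma$ be the permutation $x\mapsto x+\rho \bmod N$ of $\{0,\ldots,N-1\}$, and let $v=a_0\cdots a_{N-1}$ be the word $\ell(0)\ell(\sigma(0))\cdots\ell(\sigma^{N-1}(0))$ with $\ell(x)=a$ if $x<\gamma$ and $\ell(x)=c$ otherwise (this is the lower Christoffel word with $\gamma$ letters $a$ and $\rho$ letters $c$). Let $\gamma^*\in\{1,\ldots,N-1\}$ be the inverse of $\gamma$ modulo $N$. For $n=N-2,\ldots,N-\gamma-1$ put $i=N-1-n$, let $\sigma_n$ be the cyclic restriction of $\sigma$ to $\{0,\ldots,n\}$, and let $v_n=\ell_i(0)\ell_i(\sigma_n(0))\cdots\ell_i(\sigma_n^{n}(0))$, where $\ell_i(x)=a$ if $x<\gamma-i$, $\ell_i(x)=b$ if $\gamma-i\le x<\gamma$, $\ell_i(x)=c$ if $x\ge\gamma$. Then for each $j=1,\ldots,i$, letting $p_j=j\gamma^*\bmod N$, the factor $a_{p_j-1}a_{p_j}$ of $v$ equals $ac$; these $i$ factors are pairwise non-overlapping; and $v_n$ is obtained from $v$ by replacing each of the factors $a_{p_j-1}a_{p_j}$, $j=1,\ldots,i$, by the single letter $b$.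
   Context: Positions are indexed from $0$. The cyclic restriction of a permutation $\sigma$ of $\{0,\ldots,N-1\}$ to $\{0,\ldots,k-1\}$ is the permutation of $\{0,\ldots,k-1\}$ obtained by deleting, in a cycle decomposition of $\sigma$, all numbers $\ge k$ (the result does not depend on the chosen cycle form). -}

module Defs where

open import Data.Nat using (ℕ; zero; suc; _+_; _*_; _∸_; _%_; _<ᵇ_; _≡ᵇ_)
open import Data.Bool using (Bool; if_then_else_)
open import Data.List using (List; []; _∷_; map; upTo)
open import Data.Bool.ListAction using (any)

data Letter : Set where
  a b c : Letter

-- x mod m (with the harmless convention x mod 0 = x; only used with m = N > 0).
_mod_ : ℕ → ℕ → ℕ
x mod zero    = x
x mod (suc m) = x % suc m

iter : (ℕ → ℕ) → ℕ → ℕ → ℕ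
iter f zero    x = x
iter f (suc k) x = f (iter f k x)

σ : ℕ → ℕ → ℕ → ℕ
σ γ ρ x = (x + ρ) mod (γ + ρ)

-- Cyclic restriction of a permutation f of {0..N-1} to {0..k-1}:
-- deleting the numbers ≥ k from the cycle of x means that x is sent to the
-- first element of f x, f² x, … that lies below k (at most N steps are needed).
cycRestr : (ℕ → ℕ) → ℕ → ℕ → ℕ → ℕ
cycRestr f N k x = go N (f x)
  where
  go : ℕ → ℕ → ℕ
  go zero    y = y
  go (suc t) y = if y <ᵇ k then y else go t (f y)

ℓ : ℕ → ℕ → Letter
ℓ γ x = if x <ᵇ γ then a else c

ℓᵢ : ℕ → ℕ → ℕ → Letter
ℓᵢ γ i x = if x <ᵇ (γ ∸ i) then a else (if x <ᵇ γ then b else c)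

letterAt : ℕ → ℕ → ℕ → Letter
letterAt γ ρ p = ℓ γ (iter (σ γ ρ) p 0)

v : ℕ → ℕ → List Letter
v γ ρ = map (letterAt γ ρ) (upTo (γ + ρ))

vₙ : ℕ → ℕ → ℕ → List Letter
vₙ γ ρ n =
  map (λ t → ℓᵢ γ (γ + ρ ∸ 1 ∸ n) (iter (cycRestr (σ γ ρ) (γ + ρ) (suc n)) t 0))
      (upTo (suc n))

_∈ᵇ_ : ℕ → List ℕ → Bool
x ∈ᵇ P = any (λ y → y ≡ᵇ x) P

-- replaceFactors P k w : w is a word whose first letter has position k;
-- every factor w_{p-1} w_p with p ∈ P is replaced by the single letter b
-- (scanning left to right; P is assumed to describe non-overlapping factors).
replaceFactors : List ℕ → ℕ → List Letter → List Letter
replaceFactors P k []          = []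
replaceFactors P k (x ∷ [])    = x ∷ []
replaceFactors P k (x ∷ y ∷ r) =
  if suc k ∈ᵇ P then b ∷ replaceFactors P (suc (suc k)) r
  else x ∷ replaceFactors P (suc k) (y ∷ r)

-- The orbit of 0 under σ is σᵗ(0) ≡ tρ ≡ −tγ (mod N), so the letter at position
-- pⱼ = jγ* is read at σ^{pⱼ}(0) = N − j. For j ≤ γ this value is ≥ ρ > γ, hence a c,
-- and as σ lowers a value ≥ γ below ρ, the letter before it is read below γ, hence an a.
-- Restricting σ to {0, …, n} with n + 1 = N − i removes exactly the values N − 1, …, N − i,
-- i.e. the positions p₁, …, pᵢ; these are never adjacent, so σₙ simply skips each of them,
-- and the value y < γ preceding one satisfies y + ρ ≥ N − i, i.e. γ − i ≤ y, so ℓᵢ(y) = b.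
module Submission where

open import Defs
open import Data.Nat
open import Data.Nat.Coprimality using (Coprime)
open import Data.Nat.Properties
open import Data.Nat.DivMod using (%-distribˡ-+; %-distribˡ-*; m%n%n≡m%n; m*n%n≡0; n%n≡0; m<n⇒m%n≡m; m≤n⇒[n∸m]%m≡n%m; m%n<n; [m+n]%n≡m%n)
open import Data.Nat.Solver using (module +-*-Solver)
open +-*-Solver using (solve; _:+_; _:*_; _:=_)
open import Data.Bool using (true; false; if_then_else_)
open import Data.Bool.Properties using (T-≡)
open import Data.List using (List; []; _∷_; map; upTo; applyUpTo; iterate; length)
open import Data.List.Properties using (map-upTo; map-∘; length-map; length-upTo)
open import Data.List.Membership.Propositional using (_∈_; _∉_)
open import Data.List.Membership.Propositional.Properties using (∈-map⁺; ∈-map⁻; ∈-upTo⁺; ∈-upTo⁻)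
open import Data.List.Membership.DecPropositional _≟_ using (_∈?_)
open import Data.List.Relation.Unary.Any using (here; there)
import Data.List.Relation.Unary.Any as Any
open import Data.List.Relation.Unary.Any.Properties using (any⁺; any⁻)
open import Data.List.Relation.Unary.All.Properties using (All¬⇒¬Any)
open import Data.List.Relation.Unary.Unique.Propositional using (Unique; _∷_)
open import Data.List.Relation.Unary.Unique.Propositional.Properties using (applyUpTo⁺₁)
open import Data.Product using (Σ; _×_; _,_; proj₁; proj₂)
open import Data.Sum using ([_,_]′)
open import Function using (_∘_; Equivalence)
open import Level using (0ℓ)
open import Relation.Nullary using (yes; no; contradiction)
open import Relation.Nullary.Decidable using (dec-true; dec-false; toSum)
open import Relation.Binary.Bundles using (Setoid)
import Relation.Binary.Reasoning.Setoid as SetoidReasoning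
open import Relation.Binary.PropositionalEquality

<ᵇ-true : ∀ {m n} → m < n → (m <ᵇ n) ≡ true
<ᵇ-true {m} {n} = dec-true (m <? n)

<ᵇ-false : ∀ {m n} → n ≤ m → (m <ᵇ n) ≡ false
<ᵇ-false {m} {n} n≤m = dec-false (m <? n) (≤⇒≯ n≤m)

<ᵇ-skip : ∀ {t x} → x ≢ suc t → (t <ᵇ x) ≡ (suc t <ᵇ x)
<ᵇ-skip {t} {x} x≢1+t with t <? x
... | no t≮x = trans (<ᵇ-false (≮⇒≥ t≮x)) (sym (<ᵇ-false (≤-trans (≮⇒≥ t≮x) (n≤1+n t))))
... | yes t<x = trans (<ᵇ-true t<x) (sym (<ᵇ-true (≤∧≢⇒< t<x (x≢1+t ∘ sym))))

∈ᵇ-true : ∀ {x xs} → x ∈ xs → (x ∈ᵇ xs) ≡ true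
∈ᵇ-true {x} {xs} x∈xs =
  Equivalence.to T-≡ (any⁺ (_≡ᵇ x) (Any.map (λ x≡y → ≡⇒≡ᵇ _ x (sym x≡y)) x∈xs))

∈ᵇ-false : ∀ {x xs} → x ∉ xs → (x ∈ᵇ xs) ≡ false
∈ᵇ-false {x} {xs} x∉xs with x ∈ᵇ xs in e
... | false = refl
... | true = contradiction (Any.map (λ y≡x → sym (≡ᵇ⇒≡ _ x y≡x)) (any⁻ (_≡ᵇ x) xs (Equivalence.from T-≡ e))) x∉xs

countAbove : ℕ → List ℕ → ℕ
countAbove t []       = 0
countAbove t (x ∷ xs) = if t <ᵇ x then suc (countAbove t xs) else countAbove t xs

countAbove-suc-∉ : ∀ {t} xs → suc t ∉ xs → countAbove (suc t) xs ≡ countAbove t xs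
countAbove-suc-∉ []       _     = refl
countAbove-suc-∉ (x ∷ xs) 1+t∉ rewrite <ᵇ-skip (λ x≡1+t → 1+t∉ (here (sym x≡1+t)))
                                    | countAbove-suc-∉ xs (1+t∉ ∘ there) = refl

countAbove-suc-∈ : ∀ {t xs} → Unique xs → suc t ∈ xs → countAbove t xs ≡ suc (countAbove (suc t) xs)
countAbove-suc-∈ {t} {x ∷ xs} (x∉xs ∷ _) (here refl)
  rewrite <ᵇ-true (n<1+n t) | <ᵇ-false (≤-refl {suc t}) =
  cong suc (sym (countAbove-suc-∉ xs (All¬⇒¬Any x∉xs)))
countAbove-suc-∈ {t} {x ∷ xs} (x∉xs ∷ xs-unique) (there 1+t∈xs) with x ≟ suc t
... | yes refl = contradiction 1+t∈xs (All¬⇒¬Any x∉xs)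
... | no x≢1+t rewrite <ᵇ-skip x≢1+t | countAbove-suc-∈ xs-unique 1+t∈xs with suc t <ᵇ x
...   | true  = refl
...   | false = refl

countAbove-≥ : ∀ {t} xs → (∀ {x} → x ∈ xs → x ≤ t) → countAbove t xs ≡ 0
countAbove-≥ []       _   = refl
countAbove-≥ (x ∷ xs) xs≤t rewrite <ᵇ-false (xs≤t (here refl)) = countAbove-≥ xs (xs≤t ∘ there)

countAbove-0 : ∀ xs → (∀ {x} → x ∈ xs → 0 < x) → countAbove 0 xs ≡ length xs
countAbove-0 []       _    = refl
countAbove-0 (x ∷ xs) xs>0 rewrite <ᵇ-true (xs>0 (here refl)) = cong suc (countAbove-0 xs (xs>0 ∘ there))

replaceFactors-∈ : ∀ {P t x y w} → suc t ∈ P →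
                   replaceFactors P t (x ∷ y ∷ w) ≡ b ∷ replaceFactors P (suc (suc t)) w
replaceFactors-∈ 1+t∈P rewrite ∈ᵇ-true 1+t∈P = refl

replaceFactors-∉ : ∀ {P t x y w} → suc t ∉ P →
                   replaceFactors P t (x ∷ y ∷ w) ≡ x ∷ replaceFactors P (suc t) (y ∷ w)
replaceFactors-∉ 1+t∉P rewrite ∈ᵇ-false 1+t∉P = refl

orbit : (ℕ → ℕ) → ℕ → ℕ
orbit f t = iter f t 0

iter-shift : ∀ f y t → f (iter f t y) ≡ iter f t (f y)
iter-shift f y zero    = refl
iter-shift f y (suc t) = cong f (iter-shift f y t)

applyUpTo-iterate : ∀ {g} f y k → (∀ t → g t ≡ iter f t y) → applyUpTo g k ≡ iterate f y k
applyUpTo-iterate f y zero    _    = refl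
applyUpTo-iterate f y (suc k) g≗f^ =
  cong₂ _∷_ (g≗f^ 0) (applyUpTo-iterate f (f y) k (λ t → trans (g≗f^ (suc t)) (iter-shift f y t)))

map-orbit : ∀ {A : Set} (h : ℕ → A) f k → map (λ t → h (orbit f t)) (upTo k) ≡ map h (iterate f 0 k)
map-orbit h f k =
  trans (map-∘ (upTo k)) (cong (map h) (trans (map-upTo (orbit f) k) (applyUpTo-iterate f 0 k (λ _ → refl))))

cycRestr-next : ∀ {f M k x} → 1 ≤ M → f x < k → cycRestr f M k x ≡ f x
cycRestr-next {M = suc M} _ fx<k rewrite <ᵇ-true fx<k = refl

cycRestr-skip : ∀ {f M k x} → 2 ≤ M → k ≤ f x → f (f x) < k → cycRestr f M k x ≡ f (f x)
cycRestr-skip {M = suc (suc M)} _ k≤fx ffx<k rewrite <ᵇ-false k≤fx | <ᵇ-true ffx<k = refl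
cycRestr-skip {M = suc zero} (s≤s ())

module OrbitDeletion
  (f : ℕ → ℕ) (N k : ℕ) (ℓ ℓ′ : ℕ → Letter) (L : List ℕ)
  (2≤N : 2 ≤ N) (0<k : 0 < k) (orbit-N : orbit f N ≡ 0)
  (L-unique : Unique L)
  (∈L⇒deleted : ∀ {u} → u ∈ L → u < N × k ≤ orbit f u)
  (deleted⇒∈L : ∀ {u} → u < N → k ≤ orbit f u → u ∈ L)
  (deleted⇒next-kept : ∀ u → k ≤ orbit f u → orbit f (suc u) < k)
  (ℓ′-kept : ∀ {y} → f y < k → ℓ′ y ≡ ℓ y)
  (ℓ′-merged : ∀ {y} → y < k → k ≤ f y → ℓ′ y ≡ b)
  where

  fₖ : ℕ → ℕ
  fₖ = cycRestr f N k

  kept-next : ∀ {t} → suc t < N → suc t ∉ L → orbit f (suc t) < k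
  kept-next {t} 1+t<N 1+t∉L with orbit f (suc t) <? k
  ... | yes kept = kept
  ... | no ¬kept = contradiction (deleted⇒∈L 1+t<N (≮⇒≥ ¬kept)) 1+t∉L

  countAbove-end : ∀ {t} → N ≤ suc t → countAbove t L ≡ 0
  countAbove-end N≤1+t = countAbove-≥ L (λ u∈L → s≤s⁻¹ (≤-trans (proj₁ (∈L⇒deleted u∈L)) N≤1+t))

  -- The suffix from a kept position t, after replacement, is read along the orbit of fₖ;
  -- it is shorter by one letter for each deleted position beyond t.
  SuffixReplaced : ℕ → ℕ → Set
  SuffixReplaced r t =
    Σ ℕ λ m → replaceFactors L t (map ℓ (iterate f (orbit f t) r)) ≡ map ℓ′ (iterate fₖ (orbit f t) m)
            × m + countAbove t L ≡ r

  kept-step : ∀ {t r} → suc t ∉ L → orbit f (suc t) < k →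
              SuffixReplaced (suc r) (suc t) → SuffixReplaced (suc (suc r)) t
  kept-step {t} {r} 1+t∉L kept′ (m , replaced , counted) =
    suc m , word , cong suc (trans (cong (m +_) (sym (countAbove-suc-∉ L 1+t∉L))) counted)
    where
    open ≡-Reasoning
    word : replaceFactors L t (map ℓ (iterate f (orbit f t) (suc (suc r)))) ≡ map ℓ′ (iterate fₖ (orbit f t) (suc m))
    word = begin
      replaceFactors L t (map ℓ (iterate f (orbit f t) (suc (suc r))))
        ≡⟨ replaceFactors-∉ {w = map ℓ (iterate f (orbit f (suc (suc t))) r)} 1+t∉L ⟩
      ℓ (orbit f t) ∷ replaceFactors L (suc t) (map ℓ (iterate f (orbit f (suc t)) (suc r)))
        ≡⟨ cong₂ _∷_ (sym (ℓ′-kept kept′)) replaced ⟩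
      ℓ′ (orbit f t) ∷ map ℓ′ (iterate fₖ (orbit f (suc t)) m)
        ≡⟨ cong (λ y → ℓ′ (orbit f t) ∷ map ℓ′ (iterate fₖ y m)) (sym (cycRestr-next (≤-trans (s≤s z≤n) 2≤N) kept′)) ⟩
      map ℓ′ (iterate fₖ (orbit f t) (suc m)) ∎

  merge-step : ∀ {t r} → suc t ∈ L → orbit f t < k → orbit f (suc (suc t)) < k →
               SuffixReplaced r (suc (suc t)) → SuffixReplaced (suc (suc r)) t
  merge-step {t} {r} 1+t∈L kept kept″ (m , replaced , counted) =
    suc m , word , cong suc (trans (cong (m +_) count-drop) (trans (+-suc m _) (cong suc counted)))
    where
    open ≡-Reasoning
    deleted : k ≤ orbit f (suc t)
    deleted = proj₂ (∈L⇒deleted 1+t∈L)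
    2+t∉L : suc (suc t) ∉ L
    2+t∉L 2+t∈L = <⇒≱ kept″ (proj₂ (∈L⇒deleted 2+t∈L))
    count-drop : countAbove t L ≡ suc (countAbove (suc (suc t)) L)
    count-drop = trans (countAbove-suc-∈ L-unique 1+t∈L) (cong suc (sym (countAbove-suc-∉ L 2+t∉L)))
    word : replaceFactors L t (map ℓ (iterate f (orbit f t) (suc (suc r)))) ≡ map ℓ′ (iterate fₖ (orbit f t) (suc m))
    word = begin
      replaceFactors L t (map ℓ (iterate f (orbit f t) (suc (suc r))))
        ≡⟨ replaceFactors-∈ {w = map ℓ (iterate f (orbit f (suc (suc t))) r)} 1+t∈L ⟩
      b ∷ replaceFactors L (suc (suc t)) (map ℓ (iterate f (orbit f (suc (suc t))) r))
        ≡⟨ cong₂ _∷_ (sym (ℓ′-merged kept deleted)) replaced ⟩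
      ℓ′ (orbit f t) ∷ map ℓ′ (iterate fₖ (orbit f (suc (suc t))) m)
        ≡⟨ cong (λ y → ℓ′ (orbit f t) ∷ map ℓ′ (iterate fₖ y m)) (sym (cycRestr-skip 2≤N deleted kept″)) ⟩
      map ℓ′ (iterate fₖ (orbit f t) (suc m)) ∎

  suffixReplaced : ∀ r t → t + r ≡ N → orbit f t < k → SuffixReplaced r t
  suffixReplaced zero t t+0≡N _ =
    0 , refl , countAbove-end (≤-trans (≤-reflexive (trans (sym t+0≡N) (+-identityʳ t))) (n≤1+n t))
  suffixReplaced (suc zero) t t+1≡N _ =
    1 , cong (_∷ []) (sym (ℓ′-kept last-kept)) , cong suc (countAbove-end (≤-reflexive (trans (sym t+1≡N) (+-comm t 1))))
    where
    last-kept : f (orbit f t) < k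
    last-kept = subst (_< k) (sym (trans (cong (orbit f) (trans (+-comm 1 t) t+1≡N)) orbit-N)) 0<k
  suffixReplaced (suc (suc r)) t t+r+2≡N kept =
    [ (λ 1+t∈L → let kept″ = deleted⇒next-kept (suc t) (proj₂ (∈L⇒deleted 1+t∈L))
                 in merge-step 1+t∈L kept kept″ (suffixReplaced r (suc (suc t)) [2+t]+r≡N kept″))
    , (λ 1+t∉L → let kept′ = kept-next (subst (suc t <_) [1+t]+[1+r]≡N (m<m+n (suc t) z<s)) 1+t∉L
                 in kept-step 1+t∉L kept′ (suffixReplaced (suc r) (suc t) [1+t]+[1+r]≡N kept′))
    ]′ (toSum (suc t ∈? L))
    where
    [1+t]+[1+r]≡N : suc t + suc r ≡ N
    [1+t]+[1+r]≡N = trans (sym (+-suc t (suc r))) t+r+2≡N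
    [2+t]+r≡N : suc (suc t) + r ≡ N
    [2+t]+r≡N = trans (cong suc (sym (+-suc t r))) [1+t]+[1+r]≡N

  L-positive : ∀ {u} → u ∈ L → 0 < u
  L-positive {zero}  0∈L = contradiction (proj₂ (∈L⇒deleted 0∈L)) (<⇒≱ 0<k)
  L-positive {suc u} _   = z<s

  replaceFactors-orbit : replaceFactors L 0 (map ℓ (iterate f 0 N)) ≡ map ℓ′ (iterate fₖ 0 (N ∸ length L))
  replaceFactors-orbit with suffixReplaced N 0 refl 0<k
  ... | m , replaced , counted = trans replaced (cong (map ℓ′ ∘ iterate fₖ 0) m≡N∸|L|)
    where
    open ≡-Reasoning
    m≡N∸|L| : m ≡ N ∸ length L
    m≡N∸|L| = begin
      m                             ≡⟨ sym (m+n∸n≡m m (length L)) ⟩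
      m + length L ∸ length L       ≡⟨ cong (λ q → m + q ∸ length L) (sym (countAbove-0 L L-positive)) ⟩
      m + countAbove 0 L ∸ length L ≡⟨ cong (_∸ length L) counted ⟩
      N ∸ length L                  ∎


m+n≡o+p⇒n≤p⇒o≤m : ∀ {m n o p} → m + n ≡ o + p → n ≤ p → o ≤ m
m+n≡o+p⇒n≤p⇒o≤m {m} {n} {o} {p} m+n≡o+p n≤p = +-cancelʳ-≤ p o m (subst (_≤ m + p) m+n≡o+p (+-monoʳ-≤ m n≤p))

module Congruence (N : ℕ) .{{_ : NonZero N}} where

  -- A record rather than a synonym for x % N ≡ y % N, so that unification can
  -- recover x and y and the congruence lemmas need no explicit arguments.
  infix 4 _≈_
  record _≈_ (x y : ℕ) : Set where
    constructor mod
    field ≡-mod : x % N ≡ y % N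
  open _≈_

  ≈-refl : ∀ {x} → x ≈ x
  ≈-refl = mod refl

  ≈-setoid : Setoid 0ℓ 0ℓ
  ≈-setoid = record
    { Carrier       = ℕ
    ; _≈_           = _≈_
    ; isEquivalence = record
      { refl  = ≈-refl
      ; sym   = λ x≈y → mod (sym (≡-mod x≈y))
      ; trans = λ x≈y y≈z → mod (trans (≡-mod x≈y) (≡-mod y≈z))
      }
    }

  module ≈-Reasoning = SetoidReasoning ≈-setoid

  ≈-+ : ∀ {x x′ y y′} → x ≈ x′ → y ≈ y′ → x + y ≈ x′ + y′
  ≈-+ {x} {x′} {y} {y′} (mod x≈x′) (mod y≈y′) = mod (begin
    (x + y) % N           ≡⟨ %-distribˡ-+ x y N ⟩
    (x % N + y % N) % N   ≡⟨ cong₂ (λ u v → (u + v) % N) x≈x′ y≈y′ ⟩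
    (x′ % N + y′ % N) % N ≡⟨ %-distribˡ-+ x′ y′ N ⟨
    (x′ + y′) % N         ∎)
    where open ≡-Reasoning

  ≈-* : ∀ {x x′ y y′} → x ≈ x′ → y ≈ y′ → x * y ≈ x′ * y′
  ≈-* {x} {x′} {y} {y′} (mod x≈x′) (mod y≈y′) = mod (begin
    (x * y) % N           ≡⟨ %-distribˡ-* x y N ⟩
    (x % N * (y % N)) % N ≡⟨ cong₂ (λ u v → (u * v) % N) x≈x′ y≈y′ ⟩
    (x′ % N * (y′ % N)) % N ≡⟨ %-distribˡ-* x′ y′ N ⟨
    (x′ * y′) % N         ∎)
    where open ≡-Reasoning

  +-congˡ : ∀ z {x y} → x ≈ y → z + x ≈ z + y
  +-congˡ z x≈y = ≈-+ (≈-refl {z}) x≈y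

  +-congʳ : ∀ z {x y} → x ≈ y → x + z ≈ y + z
  +-congʳ z x≈y = ≈-+ x≈y (≈-refl {z})

  *-congˡ : ∀ z {x y} → x ≈ y → z * x ≈ z * y
  *-congˡ z x≈y = ≈-* (≈-refl {z}) x≈y

  *-congʳ : ∀ z {x y} → x ≈ y → x * z ≈ y * z
  *-congʳ z x≈y = ≈-* x≈y (≈-refl {z})

  %-≈ : ∀ x → x % N ≈ x
  %-≈ x = mod (m%n%n≡m%n x N)

  0%N≡0 : 0 % N ≡ 0
  0%N≡0 = m<n⇒m%n≡m (>-nonZero⁻¹ N)

  N≈0 : N ≈ 0
  N≈0 = mod (trans (n%n≡0 N) (sym 0%N≡0))

  *N≈0 : ∀ x → x * N ≈ 0
  *N≈0 x = mod (trans (m*n%n≡0 x N) (sym 0%N≡0))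

  ≈⇒≡ : ∀ {x y} → x < N → y < N → x ≈ y → x ≡ y
  ≈⇒≡ x<N y<N (mod x≈y) = trans (sym (m<n⇒m%n≡m x<N)) (trans x≈y (m<n⇒m%n≡m y<N))

  ≈0⇒≡N : ∀ {x} → x ≈ 0 → 0 < x → x < N + N → x ≡ N
  ≈0⇒≡N {x} x≈0 0<x x<2N with x <? N
  ... | yes x<N = contradiction (≈⇒≡ x<N (>-nonZero⁻¹ N) x≈0) (>⇒≢ 0<x)
  ... | no x≮N = begin
    x         ≡⟨ m∸n+n≡m N≤x ⟨
    x ∸ N + N ≡⟨ cong (_+ N) x∸N≡0 ⟩
    N         ∎
    where
    open ≡-Reasoning
    N≤x : N ≤ x
    N≤x = ≮⇒≥ x≮N
    x∸N≡0 : x ∸ N ≡ 0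
    x∸N≡0 = ≈⇒≡ (subst (x ∸ N <_) (m+n∸n≡m N N) (∸-monoˡ-< x<2N N≤x)) (>-nonZero⁻¹ N)
                 (mod (trans (m≤n⇒[n∸m]%m≡n%m N≤x) (≡-mod x≈0)))

ℓ-low : ∀ {γ y} → y < γ → ℓ γ y ≡ a
ℓ-low y<γ rewrite <ᵇ-true y<γ = refl

ℓ-high : ∀ {γ y} → γ ≤ y → ℓ γ y ≡ c
ℓ-high γ≤y rewrite <ᵇ-false γ≤y = refl

-- γ is written suc g so that N = γ + ρ reduces to suc (g + ρ) and _mod_ N to _% N.
module Christoffel (g ρ γ* : ℕ) (γ<ρ : suc g < ρ) (γγ*≡1 : (suc g * γ*) % suc (g + ρ) ≡ 1) where

  γ N : ℕ
  γ = suc g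
  N = suc (g + ρ)

  open Congruence N

  p : ℕ → ℕ
  p j = (j * γ*) % N

  σ-orbit : ℕ → ℕ
  σ-orbit = orbit (σ γ ρ)

  0<ρ : 0 < ρ
  0<ρ = <-trans z<s γ<ρ

  γ<N : γ < N
  γ<N = s≤s (≤-trans (<⇒≤ γ<ρ) (m≤n+m ρ g))

  σ-below : ∀ {x} → x < γ → σ γ ρ x ≡ x + ρ
  σ-below x<γ = m<n⇒m%n≡m (+-monoˡ-< ρ x<γ)

  σ-above : ∀ {x} → γ ≤ x → x < N → σ γ ρ x ≡ x ∸ γ
  σ-above {x} γ≤x x<N = begin
    (x + ρ) % N         ≡⟨ cong (λ y → (y + ρ) % N) (m∸n+n≡m γ≤x) ⟨
    (x ∸ γ + γ + ρ) % N ≡⟨ cong (_% N) (+-assoc (x ∸ γ) γ ρ) ⟩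
    (x ∸ γ + N) % N     ≡⟨ [m+n]%n≡m%n (x ∸ γ) N ⟩
    (x ∸ γ) % N         ≡⟨ m<n⇒m%n≡m (≤-<-trans (m∸n≤m x γ) x<N) ⟩
    x ∸ γ               ∎
    where open ≡-Reasoning

  orbit<N : ∀ t → σ-orbit t < N
  orbit<N zero    = z<s
  orbit<N (suc t) = m%n<n (σ-orbit t + ρ) N

  orbit≈ : ∀ t → σ-orbit t ≈ t * ρ
  orbit≈ zero    = ≈-refl
  orbit≈ (suc t) = begin
    (σ-orbit t + ρ) % N ≈⟨ %-≈ (σ-orbit t + ρ) ⟩
    σ-orbit t + ρ       ≈⟨ +-congʳ ρ (orbit≈ t) ⟩
    t * ρ + ρ           ≡⟨ +-comm (t * ρ) ρ ⟩
    suc t * ρ           ∎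
    where open ≈-Reasoning

  orbit-N : σ-orbit N ≡ 0
  orbit-N = ≈⇒≡ (orbit<N N) z<s (begin
    σ-orbit N ≈⟨ orbit≈ N ⟩
    N * ρ     ≡⟨ *-comm N ρ ⟩
    ρ * N     ≈⟨ *N≈0 ρ ⟩
    0         ∎)
    where open ≈-Reasoning

  γγ*≈1 : γ * γ* ≈ 1
  γγ*≈1 = mod (trans γγ*≡1 (sym (m<n⇒m%n≡m (≤-<-trans (s≤s z≤n) γ<N))))

  orbit-p : ∀ {j} → 1 ≤ j → j < N → σ-orbit (p j) + j ≡ N
  orbit-p {j} 1≤j j<N = ≈0⇒≡N residue (≤-trans 1≤j (m≤n+m j _)) (+-mono-< (orbit<N (p j)) j<N)
    where
    open ≈-Reasoning
    residue : σ-orbit (p j) + j ≈ 0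
    residue = begin
      σ-orbit (p j) + j          ≈⟨ +-congʳ j (orbit≈ (p j)) ⟩
      p j * ρ + j                ≈⟨ +-congʳ j (*-congʳ ρ (%-≈ (j * γ*))) ⟩
      j * γ* * ρ + j             ≡⟨ cong (j * γ* * ρ +_) (*-identityʳ j) ⟨
      j * γ* * ρ + j * 1         ≈⟨ +-congˡ (j * γ* * ρ) (*-congˡ j γγ*≈1) ⟨
      j * γ* * ρ + j * (γ * γ*)  ≡⟨ solve 4 (λ j s r x → j :* s :* r :+ j :* (x :* s) := j :* s :* (x :+ r)) refl j γ* ρ γ ⟩
      j * γ* * N                 ≈⟨ *N≈0 (j * γ*) ⟩
      0                          ∎

  orbit-p⁻¹ : ∀ {t j} → t < N → σ-orbit t + j ≡ N → t ≡ p j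
  orbit-p⁻¹ {t} {j} t<N σᵗ+j≡N = ≈⇒≡ t<N (m%n<n (j * γ*) N) (begin
    t              ≡⟨ *-identityʳ t ⟨
    t * 1          ≈⟨ *-congˡ t γγ*≈1 ⟨
    t * (γ * γ*)   ≡⟨ *-assoc t γ γ* ⟨
    t * γ * γ*     ≈⟨ *-congʳ γ* tγ≈j ⟩
    j * γ*         ≈⟨ %-≈ (j * γ*) ⟨
    p j            ∎)
    where
    open ≈-Reasoning
    tγ≈j : t * γ ≈ j
    tγ≈j = begin
      t * γ                     ≡⟨ +-identityʳ (t * γ) ⟨
      t * γ + 0                 ≈⟨ +-congˡ (t * γ) N≈0 ⟨
      t * γ + N                 ≡⟨ cong (t * γ +_) σᵗ+j≡N ⟨
      t * γ + (σ-orbit t + j)   ≈⟨ +-congˡ (t * γ) (+-congʳ j (orbit≈ t)) ⟩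
      t * γ + (t * ρ + j)       ≡⟨ solve 4 (λ t x r j → t :* x :+ (t :* r :+ j) := t :* (x :+ r) :+ j) refl t γ ρ j ⟩
      t * N + j                 ≈⟨ +-congʳ j (*N≈0 t) ⟩
      j                         ∎

  orbit-after-high : ∀ u → γ ≤ σ-orbit u → σ-orbit (suc u) < ρ
  orbit-after-high u γ≤σᵘ = subst (_< ρ) (sym (σ-above γ≤σᵘ (orbit<N u)))
    (m<n+o⇒m∸n<o (σ-orbit u) γ {{>-nonZero 0<ρ}} (orbit<N u))

  p-injective : ∀ {j j′} → 1 ≤ j → j < N → 1 ≤ j′ → j′ < N → p j ≡ p j′ → j ≡ j′
  p-injective {j} {j′} 1≤j j<N 1≤j′ j′<N pj≡pj′ = +-cancelˡ-≡ (σ-orbit (p j)) j j′ (begin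
    σ-orbit (p j) + j    ≡⟨ orbit-p 1≤j j<N ⟩
    N                    ≡⟨ orbit-p 1≤j′ j′<N ⟨
    σ-orbit (p j′) + j′  ≡⟨ cong (λ u → σ-orbit u + j′) pj≡pj′ ⟨
    σ-orbit (p j) + j′   ∎)
    where open ≡-Reasoning

  ρ≤orbit-p : ∀ {j} → 1 ≤ j → j ≤ γ → ρ ≤ σ-orbit (p j)
  ρ≤orbit-p {j} 1≤j j≤γ = m+n≡o+p⇒n≤p⇒o≤m (trans (orbit-p 1≤j (≤-<-trans j≤γ γ<N)) (+-comm γ ρ)) j≤γ

  before-high : ∀ u → ρ ≤ σ-orbit u → 1 ≤ u × σ-orbit (u ∸ 1) < γ
  before-high zero    ρ≤0 = contradiction ρ≤0 (<⇒≱ 0<ρ)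
  before-high (suc q) ρ≤σᵘ with σ-orbit q <? γ
  ... | yes low = s≤s z≤n , low
  ... | no ¬low = contradiction ρ≤σᵘ (<⇒≱ (orbit-after-high q (≮⇒≥ ¬low)))

  factor-ac : ∀ {j} → 1 ≤ j → j ≤ γ →
              (1 ≤ p j) × (letterAt γ ρ (p j ∸ 1) ≡ a) × (letterAt γ ρ (p j) ≡ c)
  factor-ac {j} 1≤j j≤γ with before-high (p j) (ρ≤orbit-p 1≤j j≤γ)
  ... | 1≤pj , low = 1≤pj , ℓ-low low , ℓ-high (≤-trans (<⇒≤ γ<ρ) (ρ≤orbit-p 1≤j j≤γ))

  factors-disjoint : ∀ {j j′} → 1 ≤ j → j ≤ γ → 1 ≤ j′ → j′ ≤ γ → j ≢ j′ →
                     (p j ≢ p j′) × (suc (p j) ≢ p j′)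
  factors-disjoint {j} 1≤j j≤γ 1≤j′ j′≤γ j≢j′ =
      (λ pj≡pj′ → j≢j′ (p-injective 1≤j (≤-<-trans j≤γ γ<N) 1≤j′ (≤-<-trans j′≤γ γ<N) pj≡pj′))
    , (λ 1+pj≡pj′ → <⇒≱ (subst (λ u → σ-orbit u < ρ) 1+pj≡pj′ after) (ρ≤orbit-p 1≤j′ j′≤γ))
    where
    after : σ-orbit (suc (p j)) < ρ
    after = orbit-after-high (p j) (≤-trans (<⇒≤ γ<ρ) (ρ≤orbit-p 1≤j j≤γ))

  module Restriction (k : ℕ) (ρ≤k : ρ ≤ k) (k≤N : k ≤ N) where

    i : ℕ
    i = N ∸ k

    L : List ℕ
    L = map (λ j → p (suc j)) (upTo i)

    k+i≡N : k + i ≡ N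
    k+i≡N = m+[n∸m]≡n k≤N

    i≤γ : i ≤ γ
    i≤γ = ≤-trans (∸-monoʳ-≤ N ρ≤k) (≤-reflexive (m+n∸n≡m γ ρ))

    k≡γ∸i+ρ : k ≡ γ ∸ i + ρ
    k≡γ∸i+ρ = +-cancelʳ-≡ i k (γ ∸ i + ρ) (begin
      k + i           ≡⟨ k+i≡N ⟩
      γ + ρ           ≡⟨ cong (_+ ρ) (m∸n+n≡m i≤γ) ⟨
      γ ∸ i + i + ρ   ≡⟨ solve 3 (λ x y r → x :+ y :+ r := x :+ r :+ y) refl (γ ∸ i) i ρ ⟩
      γ ∸ i + ρ + i   ∎)
      where open ≡-Reasoning

    merged⇒b-range : ∀ {y} → y < γ → k ≤ σ γ ρ y → γ ∸ i ≤ y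
    merged⇒b-range {y} y<γ k≤σy =
      +-cancelʳ-≤ ρ (γ ∸ i) y (subst₂ _≤_ k≡γ∸i+ρ (σ-below y<γ) k≤σy)

    b-range⇒merged : ∀ {y} → y < γ → γ ∸ i ≤ y → k ≤ σ γ ρ y
    b-range⇒merged {y} y<γ γ∸i≤y =
      subst₂ _≤_ (sym k≡γ∸i+ρ) (sym (σ-below y<γ)) (+-monoˡ-≤ ρ γ∸i≤y)

    ℓᵢ-kept : ∀ {y} → σ γ ρ y < k → ℓᵢ γ i y ≡ ℓ γ y
    ℓᵢ-kept {y} σy<k with y <? γ ∸ i
    ... | yes y<γ∸i rewrite <ᵇ-true y<γ∸i | <ᵇ-true (<-≤-trans y<γ∸i (m∸n≤m γ i)) = refl
    ... | no y≮γ∸i with y <? γ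
    ...   | yes y<γ = contradiction (b-range⇒merged y<γ (≮⇒≥ y≮γ∸i)) (<⇒≱ σy<k)
    ...   | no y≮γ rewrite <ᵇ-false (≮⇒≥ y≮γ∸i) | <ᵇ-false (≮⇒≥ y≮γ) = refl

    ℓᵢ-merged : ∀ {y} → y < k → k ≤ σ γ ρ y → ℓᵢ γ i y ≡ b
    ℓᵢ-merged {y} y<k k≤σy with y <? γ
    ... | yes y<γ rewrite <ᵇ-false (merged⇒b-range y<γ k≤σy) | <ᵇ-true y<γ = refl
    ... | no y≮γ = contradiction k≤σy (<⇒≱ (≤-<-trans σy≤y y<k))
      where
      σy≤y : σ γ ρ y ≤ y
      σy≤y = ≤-trans (≤-reflexive (σ-above (≮⇒≥ y≮γ) (<-≤-trans y<k k≤N))) (m∸n≤m y γ)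

    1+j<N : ∀ {j} → j < i → suc j < N
    1+j<N j<i = ≤-<-trans (≤-trans j<i i≤γ) γ<N

    L-unique : Unique L
    L-unique = subst Unique (sym (map-upTo _ i)) (applyUpTo⁺₁ _ i distinct)
      where
      distinct : ∀ {j j′} → j < j′ → j′ < i → p (suc j) ≢ p (suc j′)
      distinct j<j′ j′<i e = <⇒≢ j<j′ (suc-injective
        (p-injective (s≤s z≤n) (1+j<N (<-trans j<j′ j′<i)) (s≤s z≤n) (1+j<N j′<i) e))

    ∈L⇒deleted : ∀ {u} → u ∈ L → u < N × k ≤ σ-orbit u
    ∈L⇒deleted u∈L with ∈-map⁻ (λ j → p (suc j)) u∈L
    ... | j , j∈upTo , refl =
      m%n<n (suc j * γ*) N , m+n≡o+p⇒n≤p⇒o≤m (trans (orbit-p (s≤s z≤n) (1+j<N j<i)) (sym k+i≡N)) j<i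
      where
      j<i : j < i
      j<i = ∈-upTo⁻ j∈upTo

    deleted⇒∈L : ∀ {u} → u < N → k ≤ σ-orbit u → u ∈ L
    deleted⇒∈L {u} u<N k≤σᵘ with m≤n⇒∃[o]m+o≡n (orbit<N u)
    ... | d , 1+σᵘ+d≡N = subst (_∈ L) (sym (orbit-p⁻¹ u<N σᵘ+1+d≡N)) (∈-map⁺ (λ j → p (suc j)) (∈-upTo⁺ d<i))
      where
      σᵘ+1+d≡N : σ-orbit u + suc d ≡ N
      σᵘ+1+d≡N = trans (+-suc (σ-orbit u) d) 1+σᵘ+d≡N
      d<i : d < i
      d<i = m+n≡o+p⇒n≤p⇒o≤m (trans (+-comm i k) (trans k+i≡N (trans (sym σᵘ+1+d≡N) (+-comm (σ-orbit u) (suc d))))) k≤σᵘ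

    deleted⇒next-kept : ∀ u → k ≤ σ-orbit u → σ-orbit (suc u) < k
    deleted⇒next-kept u k≤σᵘ = <-≤-trans (orbit-after-high u (≤-trans (<⇒≤ γ<ρ) (≤-trans ρ≤k k≤σᵘ))) ρ≤k

    open OrbitDeletion (σ γ ρ) N k (ℓ γ) (ℓᵢ γ i) L
      (s≤s (≤-trans (≤-trans (s≤s z≤n) (<⇒≤ γ<ρ)) (m≤n+m ρ g))) (≤-trans 0<ρ ρ≤k) orbit-N
      L-unique ∈L⇒deleted deleted⇒∈L deleted⇒next-kept ℓᵢ-kept ℓᵢ-merged
      using (replaceFactors-orbit)

    restricted-word : map (λ t → ℓᵢ γ i (iter (cycRestr (σ γ ρ) N k) t 0)) (upTo k)
                    ≡ replaceFactors L 0 (map (letterAt γ ρ) (upTo N))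
    restricted-word = begin
      map (λ t → ℓᵢ γ i (orbit (cycRestr (σ γ ρ) N k) t)) (upTo k)
        ≡⟨ map-orbit (ℓᵢ γ i) (cycRestr (σ γ ρ) N k) k ⟩
      map (ℓᵢ γ i) (iterate (cycRestr (σ γ ρ) N k) 0 k)
        ≡⟨ cong (map (ℓᵢ γ i) ∘ iterate (cycRestr (σ γ ρ) N k) 0) k≡N∸|L| ⟩
      map (ℓᵢ γ i) (iterate (cycRestr (σ γ ρ) N k) 0 (N ∸ length L))
        ≡⟨ replaceFactors-orbit ⟨
      replaceFactors L 0 (map (ℓ γ) (iterate (σ γ ρ) 0 N))
        ≡⟨ cong (replaceFactors L 0) (map-orbit (ℓ γ) (σ γ ρ) N) ⟨
      replaceFactors L 0 (map (letterAt γ ρ) (upTo N)) ∎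
      where
      open ≡-Reasoning
      k≡N∸|L| : k ≡ N ∸ length L
      k≡N∸|L| = begin
        k            ≡⟨ m∸[m∸n]≡n k≤N ⟨
        N ∸ i        ≡⟨ cong (N ∸_) (trans (length-map _ (upTo i)) (length-upTo i)) ⟨
        N ∸ length L ∎

lemma14 : (γ ρ γ* : ℕ) → 1 ≤ γ → γ < ρ → Coprime γ ρ →
          1 ≤ γ* → γ* < γ + ρ → (γ * γ*) mod (γ + ρ) ≡ 1 →
          (n : ℕ) → ρ ∸ 1 ≤ n → n ≤ γ + ρ ∸ 2 →
          let N = γ + ρ
              i = N ∸ 1 ∸ n
              p = λ (j : ℕ) → (j * γ*) mod N
          in ((j : ℕ) → 1 ≤ j → j ≤ i →
                (1 ≤ p j) × (letterAt γ ρ (p j ∸ 1) ≡ a) × (letterAt γ ρ (p j) ≡ c))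
           × ((j j′ : ℕ) → 1 ≤ j → j ≤ i → 1 ≤ j′ → j′ ≤ i → j ≢ j′ →
                (p j ≢ p j′) × (suc (p j) ≢ p j′))
           × (vₙ γ ρ n ≡ replaceFactors (map (λ j → p (suc j)) (upTo i)) 0 (v γ ρ))
lemma14 zero _ _ () _ _ _ _ _ _ _ _
lemma14 (suc g) ρ γ* _ γ<ρ _ _ _ γγ*≡1 n ρ∸1≤n n≤N∸2 =
    (λ _ 1≤j j≤i → factor-ac 1≤j (≤-trans j≤i i≤γ))
  , (λ _ _ 1≤j j≤i 1≤j′ j′≤i → factors-disjoint 1≤j (≤-trans j≤i i≤γ) 1≤j′ (≤-trans j′≤i i≤γ))
  , restricted-word
  where
  open Christoffel g ρ γ* γ<ρ γγ*≡1
  ρ≤1+n : ρ ≤ suc n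
  ρ≤1+n = ≤-trans (m≤n+m∸n ρ 1) (s≤s ρ∸1≤n)
  1+n≤N : suc n ≤ N
  1+n≤N = s≤s (≤-trans n≤N∸2 (m∸n≤m (g + ρ) 1))
  open Restriction (suc n) ρ≤1+n 1+n≤N
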